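{- Let $G$ be a finite simple graph with no isolated vertices. Then $B(G)\leq b(G)\leq Z(L(G))$.
   Context: For a finite simple graph $H$: colour each vertex black or white. A black vertex $v$ may force a white neighbour $w$ to become black if $w$ is the only white neighbour of $v$. A set $S\subseteq V(H)$ is a zero-forcing set if, colouring exactly the vertices of $S$ black and repeatedly applying this rule, all vertices eventually become black. The zero-forcing number $Z(H)$ is the minimum size of a zero-forcing set. Brushing: initially every vertex and every edge of $G$ is dirty. An initial configuration places a nonnegative integer number of brushes at each vertex. At each step a single remaining vertex $v$ fires; $v$ may fire only if the number of brushes currently at $v$ is at least the number of dirty edges currently incident with $v$. When $v$ fires, $v$ becomes clean, and each dirty edge incident with $v$ is traversed by at least one brush (distinct brushes for distinct edges), which cleans that edge and moves those brushes to its other endpoint; excess brushes may remain at $v$ but play no further role; $v$ and its incident edges are then removed. The process ends when no vertex can fire. A configuration cleans $G$ if some such process cleans all vertices and edges. $B(G)$ is the minimum total number of brushes in a configuration that cleans $G$ when several brushes are allowed to traverse the same edge simultaneously; $b(G)$ is the same minimum when, each time a vertex fires, exactly one brush is moved along each incident dirty edge (the remaining brushes staying at $v$). $L(G)$ denotes the line graph of $G$: its vertices are the edges of $G$, two being adjacent iff they share an endpoint in $G$. -}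

module Defs where

open import Data.Nat using (ℕ; _+_; _≤_; _<_)
open import Data.Bool using (Bool; true; false; T; _∧_; _∨_; not; if_then_else_)
open import Data.Fin using (Fin; _≟_) renaming (_<?_ to _<ᶠ?_)
open import Data.Fin.Subset using (Subset; _∈_; _∉_; ⊤; ⊥; ∣_∣; _∩_; _∪_; _─_; ⁅_⁆)
open import Data.Vec using (Vec; tabulate; sum)
open import Data.List using (List; length; concatMap; filterᵇ; allFin; lookup)
open import Data.Product using (_×_; _,_; Σ; ∃)
open import Relation.Binary.PropositionalEquality using (_≡_; _≢_)
open import Relation.Nullary.Decidable using (⌊_⌋)
open import Relation.Nullary using (¬_)
import Data.Vec

Adj : ℕ → Set
Adj n = Fin n → Fin n → Bool

IsSimple : ∀ {n} → Adj n → Set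
IsSimple {n} G = (∀ (u v : Fin n) → G u v ≡ G v u) × (∀ (v : Fin n) → G v v ≡ false)

NoIsolatedVertices : ∀ {n} → Adj n → Set
NoIsolatedVertices {n} G = ∀ (v : Fin n) → ∃ λ (u : Fin n) → T (G v u)

nbhd : ∀ {n} → Adj n → Fin n → Subset n
nbhd G v = tabulate (G v)

-- Line graph.  Edges of G are listed as pairs (i , j) with i < j and
-- G i j; the line graph has vertex set Fin (number of edges), two
-- distinct edges being adjacent iff they share an endpoint.

edgeList : ∀ {n} → Adj n → List (Fin n × Fin n)
edgeList {n} G =
  concatMap (λ i → concatMap (λ j →
      if ⌊ i <ᶠ? j ⌋ ∧ G i j then (i , j) Data.List.∷ Data.List.[] else Data.List.[])
    (allFin n)) (allFin n)

numEdges : ∀ {n} → Adj n → ℕ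
numEdges G = length (edgeList G)

edgeAt : ∀ {n} (G : Adj n) → Fin (numEdges G) → Fin n × Fin n
edgeAt G k = lookup (edgeList G) k

shareEndpoint : ∀ {n} → Fin n × Fin n → Fin n × Fin n → Bool
shareEndpoint (a , b) (c , d) =
  ⌊ a ≟ c ⌋ ∨ ⌊ a ≟ d ⌋ ∨ ⌊ b ≟ c ⌋ ∨ ⌊ b ≟ d ⌋

lineGraph : ∀ {n} (G : Adj n) → Adj (numEdges G)
lineGraph G e f = not ⌊ e ≟ f ⌋ ∧ shareEndpoint (edgeAt G e) (edgeAt G f)

data ForcesTo {m} (H : Adj m) : Subset m → Subset m → Set where
  stop  : ∀ {S} → ForcesTo H S S
  force : ∀ {S S′} (v w : Fin m) →
          v ∈ S → w ∉ S → T (H v w) →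
          (∀ u → T (H v u) → u ∉ S → u ≡ w) →
          ForcesTo H (S ∪ ⁅ w ⁆) S′ →
          ForcesTo H S S′

IsZeroForcingSet : ∀ {m} → Adj m → Subset m → Set
IsZeroForcingSet H S = ForcesTo H S ⊤

ZFSize : ∀ {m} → Adj m → ℕ → Set
ZFSize H k = Σ (Subset _) λ S → ∣ S ∣ ≡ k × IsZeroForcingSet H S

-- Brushing.
-- State: set R of vertices not yet fired (remaining) and brush counts β.
-- A dirty edge is exactly an edge both of whose endpoints remain.

dirtyDeg : ∀ {n} → Adj n → Subset n → Fin n → ℕ
dirtyDeg G R v = ∣ R ∩ nbhd G v ∣

DirtyNbr : ∀ {n} → Adj n → Subset n → Fin n → Fin n → Set
DirtyNbr G R v u = u ∈ R × T (G v u)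

total : ∀ {n} → (Fin n → ℕ) → ℕ
total β = sum (tabulate β)

ValidMoveB : ∀ {n} → Adj n → Subset n → (Fin n → ℕ) → Fin n → (Fin n → ℕ) → Set
ValidMoveB G R β v k =
  (∀ u → DirtyNbr G R v u → 1 ≤ k u) ×
  (∀ u → ¬ DirtyNbr G R v u → k u ≡ 0) ×
  total k ≤ β v

ValidMoveb : ∀ {n} → Adj n → Subset n → (Fin n → ℕ) → Fin n → (Fin n → ℕ) → Set
ValidMoveb G R β v k =
  ∀ u → k u ≡ (if G v u ∧ Data.Vec.lookup R u then 1 else 0)

Rule : ℕ → Set₁
Rule n = Adj n → Subset n → (Fin n → ℕ) → Fin n → (Fin n → ℕ) → Set

-- Cleans rule G R β : from remaining set R with brush counts β, some
-- sequence of firings fires every remaining vertex (hence cleans every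
-- vertex and every edge).
data Cleans {n} (rule : Rule n) (G : Adj n) : Subset n → (Fin n → ℕ) → Set where
  finished : ∀ {β} → Cleans rule G ⊥ β
  fire     : ∀ {R β} (v : Fin n) (k : Fin n → ℕ) →
             v ∈ R →
             dirtyDeg G R v ≤ β v →
             rule G R β v k →
             Cleans rule G (R ─ ⁅ v ⁆) (λ u → β u + k u) →
             Cleans rule G R β

BrushSizeB : ∀ {n} → Adj n → ℕ → Set
BrushSizeB G k = Σ (Fin _ → ℕ) λ β → total β ≡ k × Cleans ValidMoveB G ⊤ β

BrushSizeb : ∀ {n} → Adj n → ℕ → Set
BrushSizeb G k = Σ (Fin _ → ℕ) λ β → total β ≡ k × Cleans ValidMoveb G ⊤ β

IsMinimum : (ℕ → Set) → ℕ → Set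
IsMinimum P k = P k × (∀ j → P j → k ≤ j)

-- B ≤ b because a cleaning that sends one brush along each dirty edge is a
-- cleaning.  For b ≤ Z(L(G)) take a zero forcing set S of L(G), a set of edges
-- of G called seeds, and fire the vertices of G along the forcing process.
-- Throughout, a black edge that is still dirty is a seed, and every unfired
-- vertex keeps the brush sent by each fired neighbour.  When the edge vx forces
-- vw, all edges at x are black, so x (if still unfired) can fire after being
-- given one extra brush per dirty seed at it.  Then v holds the brush x sent
-- along vx, which pays for vw, while its other dirty edges are again seeds.
-- Each seed pays for at most one extra brush, and once every edge is black the
-- remaining vertices fire in any order; so |S| extra brushes, all placed in the
-- initial configuration, suffice.

module Submission where

open import Defs
open import Data.Bool using (Bool; true; false; T; T?; _∧_; _∨_; not; if_then_else_)
open import Data.Bool.Properties using (T-∧; T-∨; T-≡; T-not-≡; ∧-identityʳ; ∧-comm)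
open import Data.Empty using (⊥-elim)
open import Data.Fin using (Fin; zero; suc; _≟_; _<_; _<?_)
open import Data.Fin.Properties using (suc-injective; <-cmp; <-asym; <⇒≢)
open import Data.Fin.Subset using (Subset; _∈_; _∉_; _⊆_; ⊤; ∣_∣; _∩_; _∪_; _-_; ⁅_⁆)
open import Data.Fin.Subset.Properties using (Empty-unique; p─⊥≡p; _∈?_; ∈⊤; p⊆p∪q; q⊆p∪q; x∈⁅x⁆; x∈⁅y⁆⇒x≡y; x∈p∪q⁻)
open import Data.List using (List; []; _∷_; concatMap; allFin)
open import Data.List.Membership.Propositional using (lose) renaming (_∈_ to _∈ˡ_)
open import Data.List.Membership.Propositional.Properties using (∈-lookup; ∈-allFin; ∈-concatMap⁺)
open import Data.List.Relation.Binary.Disjoint.Propositional using (Disjoint)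
open import Data.List.Relation.Unary.All as All using (All; []; _∷_)
open import Data.List.Relation.Unary.All.Properties using (concat⁺; map⁺)
open import Data.List.Relation.Unary.AllPairs as AllPairs using ([]; _∷_)
import Data.List.Relation.Unary.AllPairs.Properties as AllPairs
open import Data.List.Relation.Unary.Any using (here; there; index)
open import Data.List.Relation.Unary.Any.Properties using (¬Any[]; lookup-index)
open import Data.List.Relation.Unary.Unique.Propositional using (Unique)
import Data.List.Relation.Unary.Unique.Propositional.Properties as Unique
open import Data.Nat using (ℕ; zero; suc; _+_; _∸_; _≤_; z≤n; s≤s)
open import Data.Nat.Properties
  using (≤-refl; ≤-trans; ≤-reflexive; +-mono-≤; +-monoˡ-≤; +-monoʳ-≤; m≤m+n; m≤n+m;
         +-comm; +-identityʳ; m≤n+o⇒m∸n≤o; m≤n+m∸n; +-0-commutativeMonoid; +-commutativeSemigroup;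
         module ≤-Reasoning)
open import Algebra.Properties.CommutativeMonoid.Sum +-0-commutativeMonoid
  using (sum; ∑-distrib-+; sum-cong-≗; sum-replicate-zero)
open import Algebra.Properties.CommutativeSemigroup +-commutativeSemigroup using (xy∙z≈xz∙y)
open import Data.Product using (_×_; _,_; ∃; proj₁; proj₂)
open import Data.Sum using (_⊎_; inj₁; inj₂)
open import Data.Unit using (tt)
open import Data.Vec using ([]; _∷_; lookup; tabulate)
open import Data.Vec.Properties using (lookup-zipWith; lookup∘tabulate; lookup-replicate; []=⇒lookup; lookup⇒[]=)
open import Function using (_∘_; Equivalence)
open import Relation.Binary using (tri<; tri≈; tri>)
open import Relation.Binary.PropositionalEquality using (_≡_; _≢_; refl; sym; trans; cong; cong₂; subst; subst₂)
open import Relation.Nullary using (¬_; Dec; yes; no; does)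
open import Relation.Nullary.Decidable using (⌊_⌋; dec-true; dec-false; decidable-stable; toWitness; fromWitness; fromWitnessFalse; _⊎-dec_)

open Equivalence using (to; from)

T-not⇒¬T : ∀ {b} → T (not b) → ¬ T b
T-not⇒¬T {true} ()

¬T⇒T-not : ∀ {b} → ¬ T b → T (not b)
¬T⇒T-not {true}  ¬b = ¬b tt
¬T⇒T-not {false} _  = tt

T-∧⁻ˡ : ∀ a {b} → T (a ∧ b) → T a
T-∧⁻ˡ a = proj₁ ∘ to (T-∧ {a})

T-∧⁻ʳ : ∀ a {b} → T (a ∧ b) → T b
T-∧⁻ʳ a = proj₂ ∘ to (T-∧ {a})

T-∧⁺ : ∀ {a b} → T a → T b → T (a ∧ b)
T-∧⁺ ta tb = from T-∧ (ta , tb)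

T-∨⁻ : ∀ a {b} → T (a ∨ b) → T a ⊎ T b
T-∨⁻ a = to (T-∨ {a})

T-∨⁺ˡ : ∀ a {b} → T a → T (a ∨ b)
T-∨⁺ˡ a = from (T-∨ {a}) ∘ inj₁

T-∨⁺ʳ : ∀ a {b} → T b → T (a ∨ b)
T-∨⁺ʳ a = from (T-∨ {a}) ∘ inj₂

T-does⁺ : ∀ {A : Set} (a? : Dec A) → A → T (does a?)
T-does⁺ a? a = from T-≡ (dec-true a? a)

T-does⁻ : ∀ {A : Set} (a? : Dec A) → T (does a?) → A
T-does⁻ (yes a) _ = a

T-not-does⁺ : ∀ {A : Set} (a? : Dec A) → ¬ A → T (not (does a?))
T-not-does⁺ a? ¬a = from T-not-≡ (dec-false a? ¬a)

T-not-does⁻ : ∀ {A : Set} (a? : Dec A) → T (not (does a?)) → ¬ A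
T-not-does⁻ a? t a = T-not⇒¬T t (T-does⁺ a? a)

indicator : Bool → ℕ
indicator b = if b then 1 else 0

indicator-T : ∀ {b} → T b → indicator b ≡ 1
indicator-T {true} _ = refl

indicator-¬T : ∀ {b} → ¬ T b → indicator b ≡ 0
indicator-¬T {true}  ¬b = ⊥-elim (¬b tt)
indicator-¬T {false} _  = refl

count : ∀ {a} → (Fin a → Bool) → ℕ
count p = sum (λ i → indicator (p i))

total≡sum : ∀ {a} (f : Fin a → ℕ) → total f ≡ sum f
total≡sum {zero}  f = refl
total≡sum {suc a} f = cong (f zero +_) (total≡sum (f ∘ suc))

sum-mono-≤ : ∀ {a} {f g : Fin a → ℕ} → (∀ i → f i ≤ g i) → sum f ≤ sum g
sum-mono-≤ {zero}  f≤g = z≤n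
sum-mono-≤ {suc a} f≤g = +-mono-≤ (f≤g zero) (sum-mono-≤ (f≤g ∘ suc))

sum-single : ∀ {a} (j : Fin a) (c : ℕ) → sum (λ i → if does (i ≟ j) then c else 0) ≡ c
sum-single {suc a} zero    c = trans (cong (c +_) (sum-replicate-zero a)) (+-identityʳ c)
sum-single {suc a} (suc j) c = sum-single j c

count-single : ∀ {a} (j : Fin a) (p : Fin a → Bool) → count (λ i → does (i ≟ j) ∧ p i) ≡ indicator (p j)
count-single {suc a} zero    p = trans (cong (indicator (p zero) +_) (sum-replicate-zero a)) (+-identityʳ _)
count-single {suc a} (suc j) p = count-single j (p ∘ suc)

count-none : ∀ {a} {p : Fin a → Bool} → (∀ i → ¬ T (p i)) → count p ≡ 0
count-none {a} none = trans (sum-cong-≗ (indicator-¬T ∘ none)) (sum-replicate-zero a)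

count-pos : ∀ {a} (p : Fin a → Bool) {j} → T (p j) → 1 ≤ count p
count-pos p {zero} pj with p zero
... | true = s≤s z≤n
count-pos p {suc j} pj = ≤-trans (count-pos (p ∘ suc) pj) (m≤n+m _ (indicator (p zero)))

count-≤-+ : ∀ {a} {p q r : Fin a → Bool} → (∀ i → T (p i) → T (q i) ⊎ T (r i)) →
            count p ≤ count q + count r
count-≤-+ {p = p} {q} {r} p⇒q∨r =
  ≤-trans (sum-mono-≤ pointwise) (≤-reflexive (∑-distrib-+ (indicator ∘ q) (indicator ∘ r)))
  where
  pointwise : ∀ i → indicator (p i) ≤ indicator (q i) + indicator (r i)
  pointwise i with p i | q i | r i | p⇒q∨r i
  ... | false | _     | _     | _    = z≤n
  ... | true  | true  | _     | _    = s≤s z≤n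
  ... | true  | false | true  | _    = ≤-refl
  ... | true  | false | false | q∨r with q∨r tt
  ...   | inj₁ ()
  ...   | inj₂ ()

count-+-≤ : ∀ {a} {p q r : Fin a → Bool} →
            (∀ i → T (p i) → T (r i)) → (∀ i → T (q i) → T (r i)) → (∀ i → T (p i) → ¬ T (q i)) →
            count p + count q ≤ count r
count-+-≤ {p = p} {q} {r} p⇒r q⇒r disjoint =
  ≤-trans (≤-reflexive (sym (∑-distrib-+ (indicator ∘ p) (indicator ∘ q)))) (sum-mono-≤ pointwise)
  where
  pointwise : ∀ i → indicator (p i) + indicator (q i) ≤ indicator (r i)
  pointwise i with p i | q i | r i | p⇒r i | q⇒r i | disjoint i
  ... | false | false | _     | _   | _   | _  = z≤n
  ... | true  | true  | _     | _   | _   | pq = ⊥-elim (pq tt tt)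
  ... | true  | false | true  | _   | _   | _  = ≤-refl
  ... | true  | false | false | pr  | _   | _  = ⊥-elim (pr tt)
  ... | false | true  | true  | _   | _   | _  = ≤-refl
  ... | false | true  | false | _   | qr  | _  = ⊥-elim (qr tt)

count-remove : ∀ {a} (p : Fin a → Bool) {j} → T (p j) →
               suc (count (λ i → p i ∧ not (does (i ≟ j)))) ≤ count p
count-remove p {j} pj = begin
  suc (count p∖j)                               ≡⟨ +-comm 1 (count p∖j) ⟩
  count p∖j + 1                                 ≡⟨ cong (count p∖j +_) (sym j-counted) ⟩
  count p∖j + count (λ i → does (i ≟ j) ∧ p i)  ≤⟨ count-+-≤ (λ i → T-∧⁻ˡ (p i))
                                                               (λ i → T-∧⁻ʳ (does (i ≟ j))) apart ⟩
  count p                                       ∎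
  where
  open ≤-Reasoning
  p∖j : Fin _ → Bool
  p∖j i = p i ∧ not (does (i ≟ j))
  j-counted : count (λ i → does (i ≟ j) ∧ p i) ≡ 1
  j-counted = trans (count-single j p) (indicator-T pj)
  apart : ∀ i → T (p∖j i) → ¬ T (does (i ≟ j) ∧ p i)
  apart i i∈p∖j i≡j∧pi = T-not⇒¬T (T-∧⁻ʳ (p i) i∈p∖j) (T-∧⁻ˡ (does (i ≟ j)) i≡j∧pi)

count-≤-injection : ∀ {a b} (p : Fin a → Bool) (q : Fin b → Bool) (_↦_ : Fin a → Fin b → Set) →
  (∀ i → T (p i) → ∃ λ k → T (q k) × i ↦ k) →
  (∀ {i i′ k} → T (p i) → T (p i′) → i ↦ k → i′ ↦ k → i ≡ i′) →
  count p ≤ count q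
count-≤-injection {zero}  p q _↦_ image injective = z≤n
count-≤-injection {suc a} p q _↦_ image injective with p zero in p₀
... | false = count-≤-injection (p ∘ suc) q (_↦_ ∘ suc) (image ∘ suc)
                (λ pi pi′ i↦k i′↦k → suc-injective (injective pi pi′ i↦k i′↦k))
... | true  = ≤-trans (s≤s (count-≤-injection (p ∘ suc) q∖k (_↦_ ∘ suc) image∖k
                (λ pi pi′ i↦k i′↦k → suc-injective (injective pi pi′ i↦k i′↦k))))
                (count-remove q qk)
  where
  p-zero : T (p zero)
  p-zero = from T-≡ p₀
  k : Fin _
  k = proj₁ (image zero p-zero)
  qk : T (q k)
  qk = proj₁ (proj₂ (image zero p-zero))
  q∖k : Fin _ → Bool
  q∖k k′ = q k′ ∧ not (does (k′ ≟ k))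
  image∖k : ∀ i → T (p (suc i)) → ∃ λ k′ → T (q∖k k′) × suc i ↦ k′
  image∖k i pi with image (suc i) pi
  ... | k′ , qk′ , i↦k′ = k′ , T-∧⁺ qk′ (T-not-does⁺ (k′ ≟ k) k′≢k) , i↦k′
    where
    k′≢k : k′ ≢ k
    k′≢k refl with injective pi p-zero i↦k′ (proj₂ (proj₂ (image zero p-zero)))
    ... | ()

count-mono : ∀ {a} {p q : Fin a → Bool} → (∀ i → T (p i) → T (q i)) → count p ≤ count q
count-mono {p = p} {q} p⇒q =
  count-≤-injection p q _≡_ (λ i pi → i , p⇒q i pi , refl) (λ _ _ i≡k i′≡k → trans i≡k (sym i′≡k))

∈⇒T : ∀ {a} {x : Fin a} {p : Subset a} → x ∈ p → T (lookup p x)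
∈⇒T x∈p = from T-≡ ([]=⇒lookup x∈p)

T⇒∈ : ∀ {a} {x : Fin a} {p : Subset a} → T (lookup p x) → x ∈ p
T⇒∈ {x = x} {p} t = lookup⇒[]= x p (to T-≡ t)

∣∣≡count : ∀ {a} (p : Subset a) → ∣ p ∣ ≡ count (lookup p)
∣∣≡count []          = refl
∣∣≡count (true ∷ p)  = cong suc (∣∣≡count p)
∣∣≡count (false ∷ p) = ∣∣≡count p

lookup-∩-tabulate : ∀ {a} (p : Subset a) (f : Fin a → Bool) u →
                    lookup (p ∩ tabulate f) u ≡ (lookup p u ∧ f u)
lookup-∩-tabulate p f u =
  trans (lookup-zipWith _∧_ u p (tabulate f)) (cong (lookup p u ∧_) (lookup∘tabulate f u))

lookup-remove : ∀ {a} (p : Subset a) v u → lookup (p - v) u ≡ (lookup p u ∧ not (does (u ≟ v)))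
lookup-remove (x ∷ p) zero zero with x
... | true  = refl
... | false = refl
lookup-remove (x ∷ p) zero (suc u) =
  trans (cong (λ q → lookup q u) (p─⊥≡p p)) (sym (∧-identityʳ (lookup p u)))
lookup-remove (x ∷ p) (suc v) zero with x
... | true  = refl
... | false = refl
lookup-remove (x ∷ p) (suc v) (suc u) = lookup-remove p v u

module _ {a} (p : Subset a) (v : Fin a) where

  remains-after : ∀ {u} → T (lookup (p - v) u) → T (lookup p u) × u ≢ v
  remains-after {u} t rewrite lookup-remove p v u =
    T-∧⁻ˡ (lookup p u) t , T-not-does⁻ (u ≟ v) (T-∧⁻ʳ (lookup p u) t)

  remains-after⁺ : ∀ {u} → T (lookup p u) → u ≢ v → T (lookup (p - v) u)
  remains-after⁺ {u} t u≢v rewrite lookup-remove p v u = T-∧⁺ t (T-not-does⁺ (u ≟ v) u≢v)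

  removed : ¬ T (lookup (p - v) v)
  removed t = proj₂ (remains-after t) refl

  outside-after : ∀ {u} → ¬ T (lookup (p - v) u) → ¬ T (lookup p u) ⊎ u ≡ v
  outside-after {u} u∉ with u ≟ v
  ... | yes u≡v = inj₂ u≡v
  ... | no  u≢v = inj₁ (λ u∈ → u∉ (remains-after⁺ u∈ u≢v))

dirtyDeg≡count : ∀ {n} (G : Adj n) R v → dirtyDeg G R v ≡ count (λ u → lookup R u ∧ G v u)
dirtyDeg≡count G R v =
  trans (∣∣≡count (R ∩ nbhd G v)) (sum-cong-≗ (cong indicator ∘ lookup-∩-tabulate R (G v)))

module _ {A : Set} where

  All-if-[] : ∀ {P : A → Set} b (x : A) → (T b → P x) → All P (if b then x ∷ [] else [])
  All-if-[] true  _ px = px tt ∷ []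
  All-if-[] false _ _  = []

  ∈-if-[] : ∀ b (x : A) → T b → x ∈ˡ (if b then x ∷ [] else [])
  ∈-if-[] true _ _ = here refl

  Unique-if-[] : ∀ b (x : A) → Unique (if b then x ∷ [] else [])
  Unique-if-[] true  _ = [] ∷ []
  Unique-if-[] false _ = []

  lookup-injective : ∀ {xs : List A} → Unique xs →
                     ∀ {i j} → Data.List.lookup xs i ≡ Data.List.lookup xs j → i ≡ j
  lookup-injective (x∉ ∷ _)  {zero}  {zero}  _  = refl
  lookup-injective (x∉ ∷ _)  {zero}  {suc j} eq = ⊥-elim (All.lookup x∉ (∈-lookup j) eq)
  lookup-injective (x∉ ∷ _)  {suc i} {zero}  eq = ⊥-elim (All.lookup x∉ (∈-lookup i) (sym eq))
  lookup-injective (_ ∷ xs!) {suc i} {suc j} eq = cong suc (lookup-injective xs! eq)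

  module _ {B : Set} where

    All-concatMap⁺ : ∀ {P : B → Set} {f : A → List B} → (∀ x → All P (f x)) →
                     ∀ xs → All P (concatMap f xs)
    All-concatMap⁺ all-f xs = concat⁺ (map⁺ (All.tabulate {xs = xs} (λ {x} _ → all-f x)))

    Unique-concatMap⁺ : ∀ (key : B → A) {f : A → List B} → (∀ x → All (λ y → key y ≡ x) (f x)) →
                        (∀ x → Unique (f x)) → ∀ {xs} → Unique xs → Unique (concatMap f xs)
    Unique-concatMap⁺ key {f} keyed unique {xs} xs! =
      Unique.concat⁺ (map⁺ (All.tabulate {xs = xs} (λ {x} _ → unique x)))
                     (AllPairs.map⁺ (AllPairs.map apart xs!))
      where
      apart : ∀ {x x′} → x ≢ x′ → Disjoint (f x) (f x′)
      apart x≢x′ (y∈fx , y∈fx′) =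
        x≢x′ (trans (sym (All.lookup (keyed _) y∈fx)) (All.lookup (keyed _) y∈fx′))

module EdgeList {n} (G : Adj n) where

  private
    candidate : Fin n → Fin n → List (Fin n × Fin n)
    candidate i j = if ⌊ i <? j ⌋ ∧ G i j then (i , j) ∷ [] else []

  end₁ end₂ : Fin (numEdges G) → Fin n
  end₁ k = proj₁ (edgeAt G k)
  end₂ k = proj₂ (edgeAt G k)

  edgeAt-ordered : ∀ k → end₁ k < end₂ k × T (G (end₁ k) (end₂ k))
  edgeAt-ordered k = All.lookup edgeList-ordered (∈-lookup k)
    where
    Ordered : Fin n × Fin n → Set
    Ordered (i , j) = i < j × T (G i j)
    edgeList-ordered : All Ordered (edgeList G)
    edgeList-ordered = All-concatMap⁺ (λ i → All-concatMap⁺ (λ j → All-if-[] (⌊ i <? j ⌋ ∧ G i j) (i , j)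
      (λ t → toWitness (T-∧⁻ˡ ⌊ i <? j ⌋ t) , T-∧⁻ʳ ⌊ i <? j ⌋ t)) (allFin n)) (allFin n)

  edgeAt-surjective : ∀ {i j} → i < j → T (G i j) → ∃ λ k → edgeAt G k ≡ (i , j)
  edgeAt-surjective {i} {j} i<j gij = index ij∈ , sym (lookup-index ij∈)
    where
    ij∈ : (i , j) ∈ˡ edgeList G
    ij∈ = ∈-concatMap⁺ _ (lose (∈-allFin i) (∈-concatMap⁺ (candidate i) (lose (∈-allFin j)
            (∈-if-[] (⌊ i <? j ⌋ ∧ G i j) (i , j) (T-∧⁺ (fromWitness i<j) gij)))))

  edgeAt-injective : ∀ {k k′} → edgeAt G k ≡ edgeAt G k′ → k ≡ k′
  edgeAt-injective = lookup-injective edgeList-unique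
    where
    edgeList-unique : Unique (edgeList G)
    edgeList-unique =
      Unique-concatMap⁺ proj₁
        (λ i → All-concatMap⁺ (λ j → All-if-[] (⌊ i <? j ⌋ ∧ G i j) (i , j) (λ _ → refl)) (allFin n))
        (λ i → Unique-concatMap⁺ proj₂ (λ j → All-if-[] (⌊ i <? j ⌋ ∧ G i j) (i , j) (λ _ → refl))
                 (λ j → Unique-if-[] (⌊ i <? j ⌋ ∧ G i j) (i , j)) (Unique.allFin⁺ n))
        (Unique.allFin⁺ n)

-- Incidence between vertices and edges; adjacency in the line graph

module Incidence {n} (G : Adj n) (simple : IsSimple G) where

  open EdgeList G public

  private
    symmetric = proj₁ simple
    irreflexive = proj₂ simple

  Edge : Set
  Edge = Fin (numEdges G)

  Joins : Edge → Fin n → Fin n → Set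
  Joins k y z = (end₁ k ≡ y × end₂ k ≡ z) ⊎ (end₁ k ≡ z × end₂ k ≡ y)

  Incident : Fin n → Edge → Set
  Incident y k = end₁ k ≡ y ⊎ end₂ k ≡ y

  incident? : ∀ y k → Dec (Incident y k)
  incident? y k = (end₁ k ≟ y) ⊎-dec (end₂ k ≟ y)

  joins-incident₁ : ∀ {k y z} → Joins k y z → Incident y k
  joins-incident₁ (inj₁ (e₁ , _)) = inj₁ e₁
  joins-incident₁ (inj₂ (_ , e₂)) = inj₂ e₂

  joins-incident₂ : ∀ {k y z} → Joins k y z → Incident z k
  joins-incident₂ (inj₁ (_ , e₂)) = inj₂ e₂
  joins-incident₂ (inj₂ (e₁ , _)) = inj₁ e₁

  incident-joins : ∀ {k y v w} → Joins k v w → Incident y k → y ≡ v ⊎ y ≡ w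
  incident-joins (inj₁ (e₁ , _)) (inj₁ y₁) = inj₁ (trans (sym y₁) e₁)
  incident-joins (inj₁ (_ , e₂)) (inj₂ y₂) = inj₂ (trans (sym y₂) e₂)
  incident-joins (inj₂ (e₁ , _)) (inj₁ y₁) = inj₂ (trans (sym y₁) e₁)
  incident-joins (inj₂ (_ , e₂)) (inj₂ y₂) = inj₁ (trans (sym y₂) e₂)

  joins-adjacent : ∀ {k y z} → Joins k y z → T (G y z)
  joins-adjacent {k} (inj₁ (refl , refl)) = proj₂ (edgeAt-ordered k)
  joins-adjacent {k} (inj₂ (refl , refl)) = subst T (symmetric (end₁ k) (end₂ k)) (proj₂ (edgeAt-ordered k))

  edgeBetween : ∀ {u w} → T (G u w) → ∃ λ k → Joins k u w
  edgeBetween {u} {w} g with <-cmp u w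
  ... | tri< u<w _ _ = let k , k=uw = edgeAt-surjective u<w g in k , inj₁ (cong proj₁ k=uw , cong proj₂ k=uw)
  ... | tri≈ _ refl _ = ⊥-elim (subst T (irreflexive u) g)
  ... | tri> _ _ w<u = let k , k=wu = edgeAt-surjective w<u (subst T (symmetric u w) g)
                       in k , inj₂ (cong proj₁ k=wu , cong proj₂ k=wu)

  ends-distinct : ∀ k → end₁ k ≢ end₂ k
  ends-distinct k = <⇒≢ (proj₁ (edgeAt-ordered k))

  joins-distinct : ∀ {k y z} → Joins k y z → y ≢ z
  joins-distinct {k} (inj₁ (refl , refl)) = ends-distinct k
  joins-distinct {k} (inj₂ (refl , refl)) = ends-distinct k ∘ sym

  joins-functional : ∀ {k y z z′} → Joins k y z → Joins k y z′ → z ≡ z′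
  joins-functional     (inj₁ (_ , e₂)) (inj₁ (_ , e₂′)) = trans (sym e₂) e₂′
  joins-functional {k} (inj₁ (e₁ , _)) (inj₂ (_ , e₂′)) = ⊥-elim (ends-distinct k (trans e₁ (sym e₂′)))
  joins-functional {k} (inj₂ (_ , e₂)) (inj₁ (e₁′ , _)) = ⊥-elim (ends-distinct k (trans e₁′ (sym e₂)))
  joins-functional     (inj₂ (e₁ , _)) (inj₂ (e₁′ , _)) = trans (sym e₁) e₁′

  joins-injective : ∀ {e f y z} → Joins e y z → Joins f y z → e ≡ f
  joins-injective {e} {f} je jf = edgeAt-injective (same-ends je jf)
    where
    same-ends : Joins e _ _ → Joins f _ _ → edgeAt G e ≡ edgeAt G f
    same-ends (inj₁ (a , b)) (inj₁ (a′ , b′)) = cong₂ _,_ (trans a (sym a′)) (trans b (sym b′))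
    same-ends (inj₂ (a , b)) (inj₂ (a′ , b′)) = cong₂ _,_ (trans a (sym a′)) (trans b (sym b′))
    same-ends (inj₁ (a , b)) (inj₂ (a′ , b′)) =
      ⊥-elim (<-asym (subst₂ _<_ a b (proj₁ (edgeAt-ordered e))) (subst₂ _<_ a′ b′ (proj₁ (edgeAt-ordered f))))
    same-ends (inj₂ (a , b)) (inj₁ (a′ , b′)) =
      ⊥-elim (<-asym (subst₂ _<_ a b (proj₁ (edgeAt-ordered e))) (subst₂ _<_ a′ b′ (proj₁ (edgeAt-ordered f))))

  lineGraph-adjacent : ∀ {e f y} → e ≢ f → Incident y e → Incident y f → T (lineGraph G e f)
  lineGraph-adjacent {e} {f} e≢f ye yf = T-∧⁺ (fromWitnessFalse e≢f) (share ye yf)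
    where
    share : ∀ {y} → Incident y e → Incident y f → T (shareEndpoint (edgeAt G e) (edgeAt G f))
    share (inj₁ a) (inj₁ c) = T-∨⁺ˡ ⌊ end₁ e ≟ end₁ f ⌋ (fromWitness (trans a (sym c)))
    share (inj₁ a) (inj₂ c) =
      T-∨⁺ʳ ⌊ end₁ e ≟ end₁ f ⌋ (T-∨⁺ˡ ⌊ end₁ e ≟ end₂ f ⌋ (fromWitness (trans a (sym c))))
    share (inj₂ a) (inj₁ c) =
      T-∨⁺ʳ ⌊ end₁ e ≟ end₁ f ⌋ (T-∨⁺ʳ ⌊ end₁ e ≟ end₂ f ⌋
        (T-∨⁺ˡ ⌊ end₂ e ≟ end₁ f ⌋ (fromWitness (trans a (sym c)))))
    share (inj₂ a) (inj₂ c) =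
      T-∨⁺ʳ ⌊ end₁ e ≟ end₁ f ⌋ (T-∨⁺ʳ ⌊ end₁ e ≟ end₂ f ⌋
        (T-∨⁺ʳ ⌊ end₂ e ≟ end₁ f ⌋ (fromWitness (trans a (sym c)))))

  lineGraph-adjacent⁻ : ∀ {e f} → T (lineGraph G e f) → ∃ λ v → ∃ λ x → ∃ λ w → Joins e v x × Joins f v w
  lineGraph-adjacent⁻ {e} {f} t with T-∨⁻ ⌊ end₁ e ≟ end₁ f ⌋ (T-∧⁻ʳ (not ⌊ e ≟ f ⌋) t)
  ... | inj₁ ac = end₁ e , end₂ e , end₂ f , inj₁ (refl , refl) , inj₁ (sym (toWitness ac) , refl)
  ... | inj₂ t₂ with T-∨⁻ ⌊ end₁ e ≟ end₂ f ⌋ t₂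
  ... | inj₁ ad = end₁ e , end₂ e , end₁ f , inj₁ (refl , refl) , inj₂ (refl , sym (toWitness ad))
  ... | inj₂ t₃ with T-∨⁻ ⌊ end₂ e ≟ end₁ f ⌋ t₃
  ... | inj₁ bc = end₂ e , end₁ e , end₂ f , inj₂ (refl , refl) , inj₁ (sym (toWitness bc) , refl)
  ... | inj₂ bd = end₂ e , end₁ e , end₁ f , inj₂ (refl , refl) , inj₂ (refl , sym (toWitness bd))

-- Brushing

Cleansᵇ-mono : ∀ {n} {G : Adj n} {R β β′} → (∀ u → β u ≤ β′ u) →
               Cleans ValidMoveb G R β → Cleans ValidMoveb G R β′
Cleansᵇ-mono β≤β′ finished = finished
Cleansᵇ-mono β≤β′ (fire v k v∈R can-fire move rest) =
  fire v k v∈R (≤-trans can-fire (β≤β′ v)) move (Cleansᵇ-mono (λ u → +-monoˡ-≤ (k u) (β≤β′ u)) rest)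

Cleansᵇ⇒Cleansᴮ : ∀ {n} {G : Adj n} {R β} → Cleans ValidMoveb G R β → Cleans ValidMoveB G R β
Cleansᵇ⇒Cleansᴮ finished = finished
Cleansᵇ⇒Cleansᴮ {G = G} {R} {β} (fire v k v∈R can-fire move rest) =
  fire v k v∈R can-fire (one-each , none-elsewhere , within-budget) (Cleansᵇ⇒Cleansᴮ rest)
  where
  one-each : ∀ u → DirtyNbr G R v u → 1 ≤ k u
  one-each u (u∈R , vu) = ≤-reflexive (sym (trans (move u) (indicator-T (T-∧⁺ vu (∈⇒T u∈R)))))
  none-elsewhere : ∀ u → ¬ DirtyNbr G R v u → k u ≡ 0
  none-elsewhere u ¬vu = trans (move u) (indicator-¬T (λ t → ¬vu (T⇒∈ (T-∧⁻ʳ (G v u) t) , T-∧⁻ˡ (G v u) t)))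
  within-budget : total k ≤ β v
  within-budget = begin
    total k                           ≡⟨ total≡sum k ⟩
    sum k                             ≡⟨ sum-cong-≗ (λ u → trans (move u) (cong indicator (∧-comm (G v u) _))) ⟩
    count (λ u → lookup R u ∧ G v u)  ≡⟨ sym (dirtyDeg≡count G R v) ⟩
    dirtyDeg G R v                    ≤⟨ can-fire ⟩
    β v                               ∎
    where open ≤-Reasoning

B≤b : ∀ {n} {G : Adj n} {B b} → IsMinimum (BrushSizeB G) B → BrushSizeb G b → B ≤ b
B≤b (_ , least) (β , size , cleans) = least _ (β , size , Cleansᵇ⇒Cleansᴮ cleans)

-- Brushing along a zero forcing process of the line graph

module ZeroForcing⇒Brushing {n} (G : Adj n) (simple : IsSimple G) (S : Subset (numEdges G)) where

  open Incidence G simple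

  private
    symmetric = proj₁ simple

  dirty : Subset n → Edge → Bool
  dirty R k = lookup R (end₁ k) ∧ lookup R (end₂ k)

  dirtySeeds : Subset n → ℕ
  dirtySeeds R = count (λ k → lookup S k ∧ dirty R k)

  dirtySeedsAt : Subset n → Fin n → ℕ
  dirtySeedsAt R v = count (λ k → (lookup S k ∧ dirty R k) ∧ does (incident? v k))

  firedNbrs : Subset n → Fin n → ℕ
  firedNbrs R u = count (λ w → not (lookup R w) ∧ G u w)

  sent : Subset n → Fin n → Fin n → ℕ
  sent R v u = indicator (G v u ∧ lookup R u)

  -- Bk is the current black set of the forcing process, R the set of unfired vertices.
  record Invariant (Bk : Subset (numEdges G)) (R : Subset n) (β : Fin n → ℕ) : Set where
    field
      brushes-received : ∀ u → T (lookup R u) → firedNbrs R u ≤ β u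
      dirty-black⇒seed : ∀ k → k ∈ Bk → T (dirty R k) → T (lookup S k)
      fired⇒black      : ∀ u → ¬ T (lookup R u) → ∀ k → Incident u k → k ∈ Bk

  CleansWithin : Subset n → (Fin n → ℕ) → Set
  CleansWithin R β = ∃ λ δ → total δ ≤ dirtySeeds R × Cleans ValidMoveb G R (λ u → β u + δ u)

  Cleanable : Subset (numEdges G) → Set
  Cleanable Bk = ∀ {R β} → Invariant Bk R β → CleansWithin R β

  dirty-fire : ∀ R v k → T (dirty (R - v) k) → T (dirty R k)
  dirty-fire R v k t = T-∧⁺ (proj₁ (remains-after R v (T-∧⁻ˡ (lookup (R - v) (end₁ k)) t)))
                            (proj₁ (remains-after R v (T-∧⁻ʳ (lookup (R - v) (end₁ k)) t)))

  dirty-incident : ∀ R k {y} → T (dirty R k) → Incident y k → T (lookup R y)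
  dirty-incident R k t (inj₁ refl) = T-∧⁻ˡ (lookup R (end₁ k)) t
  dirty-incident R k t (inj₂ refl) = T-∧⁻ʳ (lookup R (end₁ k)) t

  dirty-joins : ∀ R {k y z} → Joins k y z → T (lookup R y) → T (lookup R z) → T (dirty R k)
  dirty-joins R (inj₁ (refl , refl)) ty tz = T-∧⁺ ty tz
  dirty-joins R (inj₂ (refl , refl)) ty tz = T-∧⁺ tz ty

  sent-to-remaining : ∀ {R v u} → T (lookup R u) → sent R v u ≡ indicator (G u v)
  sent-to-remaining {R} {v} {u} uR =
    cong indicator (trans (cong (G v u ∧_) (to T-≡ uR)) (trans (∧-identityʳ (G v u)) (symmetric v u)))

  dirtySeeds-fire : ∀ R v → dirtySeeds (R - v) + dirtySeedsAt R v ≤ dirtySeeds R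
  dirtySeeds-fire R v = count-+-≤ still-dirty (λ k → T-∧⁻ˡ (lookup S k ∧ dirty R k)) cleaned
    where
    still-dirty : ∀ k → T (lookup S k ∧ dirty (R - v) k) → T (lookup S k ∧ dirty R k)
    still-dirty k t = T-∧⁺ (T-∧⁻ˡ (lookup S k) t) (dirty-fire R v k (T-∧⁻ʳ (lookup S k) t))
    cleaned : ∀ k → T (lookup S k ∧ dirty (R - v) k) → ¬ T ((lookup S k ∧ dirty R k) ∧ does (incident? v k))
    cleaned k t t′ = removed R v (dirty-incident (R - v) k (T-∧⁻ʳ (lookup S k) t)
                       (T-does⁻ (incident? v k) (T-∧⁻ʳ (lookup S k ∧ dirty R k) t′)))

  -- The brushes v lacks are paid for by the dirty seeds at v, which v cleans.
  fire-step : ∀ {R β v} → T (lookup R v) → dirtyDeg G R v ≤ dirtySeedsAt R v + β v →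
              CleansWithin (R - v) (λ u → β u + sent R v u) → CleansWithin R β
  fire-step {R} {β} {v} vR enough (δ′ , δ′≤ , cleans) =
    δ , total-δ≤ , fire v (sent R v) (T⇒∈ vR) can-fire (λ _ → refl) (Cleansᵇ-mono more cleans)
    where
    open ≤-Reasoning
    deficit : ℕ
    deficit = dirtyDeg G R v ∸ β v
    deficit≤ : deficit ≤ dirtySeedsAt R v
    deficit≤ = m≤n+o⇒m∸n≤o _ (β v) (subst (dirtyDeg G R v ≤_) (+-comm _ (β v)) enough)
    top-up : Fin n → ℕ
    top-up u = if does (u ≟ v) then deficit else 0
    δ : Fin n → ℕ
    δ u = δ′ u + top-up u
    total-δ≤ : total δ ≤ dirtySeeds R
    total-δ≤ = begin
      total δ                                ≡⟨ total≡sum δ ⟩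
      sum δ                                  ≡⟨ ∑-distrib-+ δ′ top-up ⟩
      sum δ′ + sum top-up                    ≡⟨ cong₂ _+_ (sym (total≡sum δ′)) (sum-single v deficit) ⟩
      total δ′ + deficit                     ≤⟨ +-mono-≤ δ′≤ deficit≤ ⟩
      dirtySeeds (R - v) + dirtySeedsAt R v  ≤⟨ dirtySeeds-fire R v ⟩
      dirtySeeds R                           ∎
    top-up-v : top-up v ≡ deficit
    top-up-v = cong (if_then deficit else 0) (dec-true (v ≟ v) refl)
    can-fire : dirtyDeg G R v ≤ β v + δ v
    can-fire = begin
      dirtyDeg G R v          ≤⟨ m≤n+m∸n _ (β v) ⟩
      β v + deficit           ≤⟨ +-monoʳ-≤ (β v) (m≤n+m deficit (δ′ v)) ⟩
      β v + (δ′ v + deficit)  ≡⟨ cong (λ t → β v + (δ′ v + t)) (sym top-up-v) ⟩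
      β v + δ v               ∎
    more : ∀ u → (β u + sent R v u) + δ′ u ≤ (β u + δ u) + sent R v u
    more u = ≤-trans (≤-reflexive (xy∙z≈xz∙y (β u) (sent R v u) (δ′ u)))
                     (+-monoˡ-≤ (sent R v u) (+-monoʳ-≤ (β u) (m≤m+n (δ′ u) (top-up u))))

  invariant-fire : ∀ {Bk Bk′ R β v} → Invariant Bk R β → Bk ⊆ Bk′ →
    (∀ {k} → k ∈ Bk′ → k ∈ Bk ⊎ Incident v k) → (∀ {k} → Incident v k → k ∈ Bk′) →
    Invariant Bk′ (R - v) (λ u → β u + sent R v u)
  invariant-fire {Bk} {Bk′} {R} {β} {v} inv Bk⊆Bk′ Bk′⊆Bk+v v-black = record
    { brushes-received = received
    ; dirty-black⇒seed = seed
    ; fired⇒black      = black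
    }
    where
    open Invariant inv
    open ≤-Reasoning
    fired-or-v : ∀ u w → T (not (lookup (R - v) w) ∧ G u w) →
                 T (not (lookup R w) ∧ G u w) ⊎ T (does (w ≟ v) ∧ G u w)
    fired-or-v u w t with outside-after R v (T-not⇒¬T (T-∧⁻ˡ (not (lookup (R - v) w)) t))
    ... | inj₁ w∉R = inj₁ (T-∧⁺ (¬T⇒T-not w∉R) (T-∧⁻ʳ (not (lookup (R - v) w)) t))
    ... | inj₂ w≡v = inj₂ (T-∧⁺ (T-does⁺ (w ≟ v) w≡v) (T-∧⁻ʳ (not (lookup (R - v) w)) t))
    received : ∀ u → T (lookup (R - v) u) → firedNbrs (R - v) u ≤ β u + sent R v u
    received u u∈ = begin
      firedNbrs (R - v) u                                 ≤⟨ count-≤-+ (fired-or-v u) ⟩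
      firedNbrs R u + count (λ w → does (w ≟ v) ∧ G u w)  ≡⟨ cong (firedNbrs R u +_) (count-single v (G u)) ⟩
      firedNbrs R u + indicator (G u v)                   ≤⟨ +-mono-≤ (brushes-received u uR)
                                                                      (≤-reflexive (sym (sent-to-remaining {R} uR))) ⟩
      β u + sent R v u                                    ∎
      where
      uR : T (lookup R u)
      uR = proj₁ (remains-after R v u∈)
    seed : ∀ k → k ∈ Bk′ → T (dirty (R - v) k) → T (lookup S k)
    seed k k∈ d with Bk′⊆Bk+v k∈
    ... | inj₁ k∈Bk = dirty-black⇒seed k k∈Bk (dirty-fire R v k d)
    ... | inj₂ vk   = ⊥-elim (removed R v (dirty-incident (R - v) k d vk))
    black : ∀ u → ¬ T (lookup (R - v) u) → ∀ k → Incident u k → k ∈ Bk′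
    black u u∉ k uk with outside-after R v u∉
    ... | inj₁ u∉R = Bk⊆Bk′ (fired⇒black u u∉R k uk)
    ... | inj₂ refl = v-black uk

  count-≤-dirtySeedsAt : ∀ {Bk R β v} → Invariant Bk R β → T (lookup R v) → (p : Fin n → Bool) →
    (∀ u → T (p u) → T (lookup R u) × T (G v u) × (∀ k → Joins k v u → k ∈ Bk)) →
    count p ≤ dirtySeedsAt R v
  count-≤-dirtySeedsAt {R = R} {v = v} inv vR p black-edge =
    count-≤-injection p _ (λ u k → Joins k v u) image (λ _ _ → joins-functional)
    where
    open Invariant inv
    image : ∀ u → T (p u) → ∃ λ k → T ((lookup S k ∧ dirty R k) ∧ does (incident? v k)) × Joins k v u
    image u pu with black-edge u pu
    ... | uR , vu , black with edgeBetween vu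
    ...   | k , kvu =
      k , T-∧⁺ (T-∧⁺ (dirty-black⇒seed k (black k kvu) d) d) (T-does⁺ (incident? v k) (joins-incident₁ kvu)) , kvu
      where
      d : T (dirty R k)
      d = dirty-joins R kvu vR uR

  dirtyDeg-≤-dirtySeedsAt : ∀ {Bk R β x} → Invariant Bk R β → T (lookup R x) →
    (∀ {k} → Incident x k → k ∈ Bk) → dirtyDeg G R x ≤ dirtySeedsAt R x
  dirtyDeg-≤-dirtySeedsAt {R = R} {x = x} inv xR x-black =
    ≤-trans (≤-reflexive (dirtyDeg≡count G R x))
      (count-≤-dirtySeedsAt inv xR _ λ u t →
        T-∧⁻ˡ (lookup R u) t , T-∧⁻ʳ (lookup R u) t , λ k kxu → x-black (joins-incident₁ kxu))

  dirtyDeg-≤-dirtySeedsAt+1 : ∀ {Bk R β v w} → Invariant Bk R β → T (lookup R v) →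
    (∀ {u k} → u ≢ w → Joins k v u → k ∈ Bk) → dirtyDeg G R v ≤ dirtySeedsAt R v + 1
  dirtyDeg-≤-dirtySeedsAt+1 {Bk} {R} {v = v} {w} inv vR black-but-w =
    ≤-trans (≤-reflexive (dirtyDeg≡count G R v))
      (≤-trans (count-≤-+ w-or-not)
        (+-mono-≤ (count-≤-dirtySeedsAt inv vR _ not-w) (≤-reflexive (count-single w (λ _ → true)))))
    where
    w-or-not : ∀ u → T (lookup R u ∧ G v u) →
               T ((lookup R u ∧ G v u) ∧ not (does (u ≟ w))) ⊎ T (does (u ≟ w) ∧ true)
    w-or-not u t with u ≟ w
    ... | yes _ = inj₂ tt
    ... | no _  = inj₁ (T-∧⁺ t tt)
    not-w : ∀ u → T ((lookup R u ∧ G v u) ∧ not (does (u ≟ w))) →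
            T (lookup R u) × T (G v u) × (∀ k → Joins k v u → k ∈ Bk)
    not-w u t = T-∧⁻ˡ (lookup R u) t₁ , T-∧⁻ʳ (lookup R u) t₁ ,
                λ k → black-but-w (T-not-does⁻ (u ≟ w) (T-∧⁻ʳ (lookup R u ∧ G v u) t))
      where
      t₁ : T (lookup R u ∧ G v u)
      t₁ = T-∧⁻ˡ (lookup R u ∧ G v u) t

  nothing-remains : ∀ {R β} → (∀ u → ¬ T (lookup R u)) → CleansWithin R β
  nothing-remains {R} none with Empty-unique {p = R} (λ (u , u∈R) → none u (∈⇒T u∈R))
  ... | refl =
    (λ _ → 0) , ≤-trans (≤-reflexive (trans (total≡sum {n} (λ _ → 0)) (sum-replicate-zero n))) z≤n , finished

  fire-all : ∀ (vs : List (Fin n)) {R β} → (∀ {u} → T (lookup R u) → u ∈ˡ vs) →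
             Invariant ⊤ R β → CleansWithin R β
  fire-all []       covered _ = nothing-remains (λ u → ¬Any[] ∘ covered)
  fire-all (v ∷ vs) {R} covered inv with T? (lookup R v)
  ... | yes vR = fire-step vR (≤-trans (dirtyDeg-≤-dirtySeedsAt inv vR (λ _ → ∈⊤)) (m≤m+n _ _))
                   (fire-all vs covered′ (invariant-fire inv (λ k∈ → k∈) inj₁ (λ _ → ∈⊤)))
    where
    covered′ : ∀ {u} → T (lookup (R - v) u) → u ∈ˡ vs
    covered′ u∈ with remains-after R v u∈
    ... | uR , u≢v with covered uR
    ...   | here u≡v   = ⊥-elim (u≢v u≡v)
    ...   | there u∈vs = u∈vs
  ... | no v∉R = fire-all vs covered′ inv
    where
    covered′ : ∀ {u} → T (lookup R u) → u ∈ˡ vs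
    covered′ uR with covered uR
    ... | here refl  = ⊥-elim (v∉R uR)
    ... | there u∈vs = u∈vs

  all-black : Cleanable ⊤
  all-black = fire-all (allFin n) (λ {u} _ → ∈-allFin u)

  module Forcing {Bk : Subset (numEdges G)} {e f : Edge} {v x w : Fin n}
                 (e∈Bk : e ∈ Bk) (f∉Bk : f ∉ Bk) (e-vx : Joins e v x) (f-vw : Joins f v w)
                 (only-white : ∀ k → T (lineGraph G e k) → k ∉ Bk → k ≡ f) where

    black-or-forced : ∀ {y k} → Incident y e → Incident y k → k ∈ Bk ⊎ k ≡ f
    black-or-forced {k = k} ye yk with k ≟ e | k ∈? Bk
    ... | yes refl | _        = inj₁ e∈Bk
    ... | no _     | yes k∈Bk = inj₁ k∈Bk
    ... | no k≢e   | no k∉Bk  = inj₂ (only-white k (lineGraph-adjacent (k≢e ∘ sym) ye yk) k∉Bk)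

    x-black : ∀ {k} → Incident x k → k ∈ Bk
    x-black xk with black-or-forced (joins-incident₂ e-vx) xk
    ... | inj₁ k∈Bk = k∈Bk
    ... | inj₂ refl with incident-joins f-vw xk
    ...   | inj₁ x≡v = ⊥-elim (joins-distinct e-vx (sym x≡v))
    ...   | inj₂ x≡w =
      ⊥-elim (f∉Bk (subst (_∈ Bk) (joins-injective e-vx (subst (Joins f v) (sym x≡w) f-vw)) e∈Bk))

    v-black-but-w : ∀ {u k} → u ≢ w → Joins k v u → k ∈ Bk
    v-black-but-w u≢w kvu with black-or-forced (joins-incident₁ e-vx) (joins-incident₁ kvu)
    ... | inj₁ k∈Bk = k∈Bk
    ... | inj₂ refl = ⊥-elim (u≢w (joins-functional kvu f-vw))

    v-black-after : ∀ {k} → Incident v k → k ∈ Bk ∪ ⁅ f ⁆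
    v-black-after vk with black-or-forced (joins-incident₁ e-vx) vk
    ... | inj₁ k∈Bk = p⊆p∪q ⁅ f ⁆ k∈Bk
    ... | inj₂ refl = q⊆p∪q Bk ⁅ f ⁆ (x∈⁅x⁆ f)

    newly-black-at-v : ∀ {k} → k ∈ Bk ∪ ⁅ f ⁆ → k ∈ Bk ⊎ Incident v k
    newly-black-at-v k∈ with x∈p∪q⁻ Bk ⁅ f ⁆ k∈
    ... | inj₁ k∈Bk = inj₁ k∈Bk
    ... | inj₂ k∈f  = inj₂ (subst (Incident v) (sym (x∈⁅y⁆⇒x≡y f k∈f)) (joins-incident₁ f-vw))

    v-remains : ∀ {R β} → Invariant Bk R β → T (lookup R v)
    v-remains {R} inv = decidable-stable (T? (lookup R v))
      (λ v∉R → f∉Bk (Invariant.fired⇒black inv v v∉R f (joins-incident₁ f-vw)))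

    fire-v : Cleanable (Bk ∪ ⁅ f ⁆) → ∀ {R β} → Invariant Bk R β → ¬ T (lookup R x) → CleansWithin R β
    fire-v next {R} {β} inv x∉R =
      fire-step vR enough (next (invariant-fire inv (p⊆p∪q ⁅ f ⁆) newly-black-at-v v-black-after))
      where
      vR : T (lookup R v)
      vR = v-remains inv
      brush-from-x : 1 ≤ β v
      brush-from-x =
        ≤-trans (count-pos (λ u → not (lookup R u) ∧ G v u) (T-∧⁺ (¬T⇒T-not x∉R) (joins-adjacent e-vx)))
                (Invariant.brushes-received inv v vR)
      enough : dirtyDeg G R v ≤ dirtySeedsAt R v + β v
      enough = ≤-trans (dirtyDeg-≤-dirtySeedsAt+1 inv vR v-black-but-w)
                       (+-monoʳ-≤ (dirtySeedsAt R v) brush-from-x)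

    fire-x-then-v : Cleanable (Bk ∪ ⁅ f ⁆) → Cleanable Bk
    fire-x-then-v next {R} inv with T? (lookup R x)
    ... | no x∉R = fire-v next inv x∉R
    ... | yes xR = fire-step xR (≤-trans (dirtyDeg-≤-dirtySeedsAt inv xR x-black) (m≤m+n _ _))
                     (fire-v next (invariant-fire inv (λ k∈ → k∈) inj₁ x-black) (removed R x))

  forcing⇒cleanable : ∀ {Bk} → ForcesTo (lineGraph G) Bk ⊤ → Cleanable Bk
  forcing⇒cleanable stop = all-black
  forcing⇒cleanable (force e f e∈Bk f∉Bk ef only-white rest) with lineGraph-adjacent⁻ ef
  ... | _ , _ , _ , e-vx , f-vw =
    Forcing.fire-x-then-v e∈Bk f∉Bk e-vx f-vw only-white (forcing⇒cleanable rest)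

  initially : Invariant S ⊤ (λ _ → 0)
  initially = record
    { brushes-received = λ u _ →
        ≤-reflexive (count-none (λ w t → T-not⇒¬T (T-∧⁻ˡ (not (lookup ⊤ w)) t) (in-⊤ w)))
    ; dirty-black⇒seed = λ k k∈S _ → ∈⇒T k∈S
    ; fired⇒black      = λ u u∉⊤ → ⊥-elim (u∉⊤ (in-⊤ u))
    }
    where
    in-⊤ : ∀ u → T (lookup ⊤ u)
    in-⊤ u = from T-≡ (lookup-replicate u true)

  zeroForcing⇒brushing : IsZeroForcingSet (lineGraph G) S →
                         ∃ λ β → total β ≤ ∣ S ∣ × Cleans ValidMoveb G ⊤ β
  zeroForcing⇒brushing forces with forcing⇒cleanable forces initially
  ... | δ , δ≤ , cleans = δ , ≤-trans δ≤ seeds≤∣S∣ , cleans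
    where
    seeds≤∣S∣ : dirtySeeds ⊤ ≤ ∣ S ∣
    seeds≤∣S∣ = ≤-trans (count-mono (λ k → T-∧⁻ˡ (lookup S k))) (≤-reflexive (sym (∣∣≡count S)))

b≤Z : ∀ {n} (G : Adj n) → IsSimple G → ∀ {b z} →
      IsMinimum (BrushSizeb G) b → ZFSize (lineGraph G) z → b ≤ z
b≤Z G simple (_ , least) (S , ∣S∣≡z , forces)
  with ZeroForcing⇒Brushing.zeroForcing⇒brushing G simple S forces
... | β , β≤∣S∣ , cleans = ≤-trans (least (total β) (β , refl , cleans)) (subst (total β ≤_) ∣S∣≡z β≤∣S∣)

-- Isolated vertices need no brushes.
corollary2 : ∀ (n : ℕ) (G : Adj n) → IsSimple G → NoIsolatedVertices G →
    ∀ (B b z : ℕ) →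
    IsMinimum (BrushSizeB G) B →
    IsMinimum (BrushSizeb G) b →
    IsMinimum (ZFSize (lineGraph G)) z →
    B ≤ b × b ≤ z
corollary2 n G simple _ B b z minB minb (zf , _) = B≤b minB (proj₁ minb) , b≤Z G simple minb zf
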